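{- Let $p$ be a prime with $p\equiv 1\pmod 4$, and for real $a$ let $(a)_p=a(a+1)\cdots(a+p-1)$. Then $$\left(\tfrac34\right)_p\equiv 3\left(\tfrac14\right)_p\pmod{p^3}.$$
   Context: Both sides are rational numbers whose denominators are powers of $4$, hence prime to $p$. For such rationals $x,y$, $x\equiv y\pmod{p^k}$ means that $x-y$, written in lowest terms, has numerator divisible by $p^k$. -}

module Defs where

open import Data.Nat using (ℕ; zero; suc; _^_)
open import Data.Integer using (ℤ; +_)
open import Data.Integer.Divisibility using (_∣_)
open import Data.Rational using (ℚ; _+_; _*_; _-_; _/_; ↥_; 1ℚ)

poch : ℚ → ℕ → ℚ
poch a zero = 1ℚ
poch a (suc n) = poch a n * (a + ((+ n) / 1))

-- x ≡ y (mod m) for rationals: numerator of x - y in lowest terms divisible by m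
-- (ℚ values in the stdlib are always stored in lowest terms)
_≡ℚ_[mod_] : ℚ → ℚ → ℕ → Set
x ≡ℚ y [mod m ] = (+ m) ∣ (↥ (x - y))

-- Write p = 4m + 1, P₃ = ∏_{k<p} (4k+3) and P₁ = ∏_{k<p} (4k+1), so that
-- (3/4)ₚ = P₃/4ᵖ and (1/4)ₚ = P₁/4ᵖ.  The proof has two halves.
--
-- 1. The integer congruence P₃ ≡ 3 P₁ (mod p³).  Split the range of k as
--    [0,2m) ∪ [2m,4m+1) for P₃ and as [0,2m+1) ∪ [2m+1,4m+1) for P₁.  The odd
--    blocks have centres 4·3m+3 = 3p and 4m+1 = p.  Pairing the other factors
--    of each block symmetrically about its middle gives pairs (cp − s)(cp + s)
--    = c²p² − s² with c ∈ {1,3}, so corresponding pairs of the P₃- and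
--    P₁-blocks agree mod p², hence so do the products of the pairs ("shells"):
--    P₃ = p·3·A₃B₃ and 3P₁ = p·3·A₁B₁ with A₃B₃ ≡ A₁B₁ (mod p²).
-- 2. Transfer to ℚ.  As unnormalised fractions (3/4)ₚ − 3(1/4)ₚ = (P₃ − 3P₁)/4ᵖ,
--    and p³ is coprime to 4, so p³ divides the reduced numerator.

module Submission where

open import Defs
open import Data.Nat using (ℕ; _^_; _%_)
open import Data.Nat.Primality using (Prime)
open import Data.Integer using (+_)
open import Data.Rational using (_/_; _*_)
open import Relation.Binary.PropositionalEquality using (_≡_)

open import Relation.Binary.PropositionalEquality
  using (refl; sym; trans; cong; cong₂; subst; subst₂; module ≡-Reasoning)
import Data.Nat as ℕ
open import Data.Nat using (zero; suc)
import Data.Nat.Properties as ℕP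
import Data.Nat.Tactic.RingSolver as ℕSolver
open import Data.Nat.DivMod using (m≡m%n+[m/n]*n)
open import Data.Nat.Divisibility using () renaming (_∣_ to _∣ℕ_)
import Data.Nat.Divisibility as ℕDiv
open import Data.Nat.Coprimality using (Coprime; coprime-divisor; coprime-+; 1-coprimeTo)
open import Data.Integer using (ℤ; _+_; _-_; -_; ∣_∣) renaming (_*_ to _·_)
import Data.Integer.Properties as ℤP
open import Data.Integer.Divisibility.Signed
  using (_∣_; divides; ∣⇒∣ᵤ; ∣m∣n⇒∣m+n; ∣m⇒∣m*n; ∣n⇒∣m*n; ∣m⇒∣-m; *-monoʳ-∣)
open import Data.Integer.Tactic.RingSolver using (solve-∀)
import Data.Rational as ℚ
import Data.Rational.Properties as ℚP
open import Data.Rational.Unnormalised as ℚᵘ using (_≃_; *≡*)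
import Data.Rational.Unnormalised.Properties as ℚᵘP

∏ : (ℕ → ℤ) → ℕ → ℕ → ℤ
∏ f a zero    = + 1
∏ f a (suc n) = ∏ f a n · f (a ℕ.+ n)

∏-head : ∀ f a n → ∏ f a (suc n) ≡ f a · ∏ f (suc a) n
∏-head f a zero    = trans (cong (λ i → + 1 · f i) (ℕP.+-identityʳ a)) (ℤP.*-comm (+ 1) (f a))
∏-head f a (suc n) = begin
    ∏ f a (suc n) · f (a ℕ.+ suc n)
  ≡⟨ cong₂ _·_ (∏-head f a n) (cong f (ℕP.+-suc a n)) ⟩
    f a · ∏ f (suc a) n · f (suc a ℕ.+ n)
  ≡⟨ ℤP.*-assoc (f a) _ _ ⟩
    f a · ∏ f (suc a) (suc n)
  ∎
  where open ≡-Reasoning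

∏-split : ∀ f a n k → ∏ f a (n ℕ.+ k) ≡ ∏ f a n · ∏ f (a ℕ.+ n) k
∏-split f a n zero    = trans (cong (∏ f a) (ℕP.+-identityʳ n)) (sym (ℤP.*-identityʳ (∏ f a n)))
∏-split f a n (suc k) = begin
    ∏ f a (n ℕ.+ suc k)
  ≡⟨ cong (∏ f a) (ℕP.+-suc n k) ⟩
    ∏ f a (n ℕ.+ k) · f (a ℕ.+ (n ℕ.+ k))
  ≡⟨ cong₂ _·_ (∏-split f a n k) (cong f (sym (ℕP.+-assoc a n k))) ⟩
    ∏ f a n · ∏ f (a ℕ.+ n) k · f (a ℕ.+ n ℕ.+ k)
  ≡⟨ ℤP.*-assoc (∏ f a n) _ _ ⟩
    ∏ f a n · ∏ f (a ℕ.+ n) (suc k)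
  ∎
  where open ≡-Reasoning

-- The shell of width j around the gap [a+j, a+j+n): the two blocks of length j
-- on either side of it.
shell : (ℕ → ℤ) → ℕ → ℕ → ℕ → ℤ
shell f a j n = ∏ f a j · ∏ f (a ℕ.+ j ℕ.+ n) j

∏-shell : ∀ f a j n → ∏ f a (j ℕ.+ n ℕ.+ j) ≡ ∏ f (a ℕ.+ j) n · shell f a j n
∏-shell f a j n = begin
    ∏ f a (j ℕ.+ n ℕ.+ j)
  ≡⟨ ∏-split f a (j ℕ.+ n) j ⟩
    ∏ f a (j ℕ.+ n) · ∏ f (a ℕ.+ (j ℕ.+ n)) j
  ≡⟨ cong₂ _·_ (∏-split f a j n) (cong (λ c → ∏ f c j) (sym (ℕP.+-assoc a j n))) ⟩
    ∏ f a j · ∏ f (a ℕ.+ j) n · ∏ f (a ℕ.+ j ℕ.+ n) j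
  ≡⟨ rearrange (∏ f a j) (∏ f (a ℕ.+ j) n) (∏ f (a ℕ.+ j ℕ.+ n) j) ⟩
    ∏ f (a ℕ.+ j) n · shell f a j n
  ∎
  where
  open ≡-Reasoning
  rearrange : ∀ (x y z : ℤ) → x · y · z ≡ y · (x · z)
  rearrange = solve-∀

shell-peel : ∀ f a j n →
  shell f a (suc j) n ≡ (f a · f (a ℕ.+ suc j ℕ.+ n ℕ.+ j)) · shell f (suc a) j n
shell-peel f a j n = begin
    ∏ f a (suc j) · ∏ f (a ℕ.+ suc j ℕ.+ n) (suc j)
  ≡⟨ cong (_· ∏ f (a ℕ.+ suc j ℕ.+ n) (suc j)) (∏-head f a j) ⟩
    f a · ∏ f (suc a) j · (∏ f (a ℕ.+ suc j ℕ.+ n) j · f (a ℕ.+ suc j ℕ.+ n ℕ.+ j))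
  ≡⟨ rearrange (f a) (∏ f (suc a) j) _ (f (a ℕ.+ suc j ℕ.+ n ℕ.+ j)) ⟩
    (f a · f (a ℕ.+ suc j ℕ.+ n ℕ.+ j)) · (∏ f (suc a) j · ∏ f (a ℕ.+ suc j ℕ.+ n) j)
  ≡⟨ cong (λ c → (f a · f (a ℕ.+ suc j ℕ.+ n ℕ.+ j)) · (∏ f (suc a) j · ∏ f (c ℕ.+ n) j))
          (ℕP.+-suc a j) ⟩
    (f a · f (a ℕ.+ suc j ℕ.+ n ℕ.+ j)) · shell f (suc a) j n
  ∎
  where
  open ≡-Reasoning
  rearrange : ∀ (x y z w : ℤ) → x · y · (z · w) ≡ (x · w) · (y · z)
  rearrange = solve-∀

-- Congruence of integers modulo a natural number:  n divides a − b.
-- (A record, so that a and b can be inferred from a proof.)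
infix 4 _≡_[modℤ_]
record _≡_[modℤ_] (a b : ℤ) (n : ℕ) : Set where
  constructor mod
  field divides-difference : + n ∣ a - b
open _≡_[modℤ_]

mod-refl : ∀ {n} a → a ≡ a [modℤ n ]
mod-refl {n} a = mod (divides (+ 0) (trans (ℤP.+-inverseʳ a) (sym (ℤP.*-zeroˡ (+ n)))))

mod-sym : ∀ {n a b} → a ≡ b [modℤ n ] → b ≡ a [modℤ n ]
mod-sym {n} {a} {b} (mod n∣a-b) = mod (subst (λ c → + n ∣ c) (negate-difference a b) (∣m⇒∣-m n∣a-b))
  where
  negate-difference : ∀ (a b : ℤ) → - (a - b) ≡ b - a
  negate-difference = solve-∀

mod-* : ∀ {n a b c d} → a ≡ b [modℤ n ] → c ≡ d [modℤ n ] → a · c ≡ b · d [modℤ n ]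
mod-* {n} {a} {b} {c} {d} (mod n∣a-b) (mod n∣c-d) =
  mod (subst (λ e → + n ∣ e) (sym (expand a b c d)) (∣m∣n⇒∣m+n (∣m⇒∣m*n c n∣a-b) (∣n⇒∣m*n b n∣c-d)))
  where
  expand : ∀ (a b c d : ℤ) → a · c - b · d ≡ (a - b) · c + b · (c - d)
  expand = solve-∀

mod-scale : ∀ {n a b} k → a ≡ b [modℤ n ] → + k · a ≡ + k · b [modℤ k ℕ.* n ]
mod-scale {n} {a} {b} k (mod n∣a-b) =
  mod (subst₂ _∣_ (sym (ℤP.pos-* k n)) (factor (+ k) a b) (*-monoʳ-∣ (+ k) n∣a-b))
  where
  factor : ∀ (k a b : ℤ) → k · (a - b) ≡ k · a - k · b
  factor = solve-∀

mod-witness : ∀ a b c d {n} q → a ℕ.* b ℕ.+ q ℕ.* n ≡ c ℕ.* d → + a · + b ≡ + c · + d [modℤ n ]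
mod-witness a b c d {n} q eq = mod (divides (- + q) (begin
    + a · + b - + c · + d
  ≡⟨ cong₂ _-_ (sym (ℤP.pos-* a b)) (sym (ℤP.pos-* c d)) ⟩
    + (a ℕ.* b) - + (c ℕ.* d)
  ≡⟨ cong (λ e → + (a ℕ.* b) - + e) (sym eq) ⟩
    + (a ℕ.* b) - + (a ℕ.* b ℕ.+ q ℕ.* n)
  ≡⟨ cong (λ e → + (a ℕ.* b) - e) (trans (ℤP.pos-+ (a ℕ.* b) (q ℕ.* n))
                                          (cong (λ e → + (a ℕ.* b) + e) (ℤP.pos-* q n))) ⟩
    + (a ℕ.* b) - (+ (a ℕ.* b) + + q · + n)
  ≡⟨ cancel (+ (a ℕ.* b)) (+ q) (+ n) ⟩
    - + q · + n
  ∎))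
  where
  open ≡-Reasoning
  cancel : ∀ (x q n : ℤ) → x - (x + q · n) ≡ - q · n
  cancel = solve-∀

-- Pairs f g a b j n M: for i + k + 1 = j, the two f-factors of the shell f a j n
-- at distance k from the gap, f(a+i) and f(a+j+n+k), have a product congruent
-- mod M to that of the corresponding g-factors of the shell g b j n.
Pairs : (ℕ → ℤ) → (ℕ → ℤ) → ℕ → ℕ → ℕ → ℕ → ℕ → Set
Pairs f g a b j n M = ∀ i k → suc (i ℕ.+ k) ≡ j →
  f (a ℕ.+ i) · f (a ℕ.+ j ℕ.+ n ℕ.+ k) ≡ g (b ℕ.+ i) · g (b ℕ.+ j ℕ.+ n ℕ.+ k) [modℤ M ]

pair-reindex : ∀ {M} (f g : ℕ → ℤ) {s s' t t' u u' v v' : ℕ} →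
  s ≡ s' → t ≡ t' → u ≡ u' → v ≡ v' →
  f s · f t ≡ g u · g v [modℤ M ] → f s' · f t' ≡ g u' · g v' [modℤ M ]
pair-reindex f g refl refl refl refl congruent = congruent

pairs-outer : ∀ {f g a b j n M} → Pairs f g a b (suc j) n M →
  f a · f (a ℕ.+ suc j ℕ.+ n ℕ.+ j) ≡ g b · g (b ℕ.+ suc j ℕ.+ n ℕ.+ j) [modℤ M ]
pairs-outer {f} {g} {a} {b} pairs =
  pair-reindex f g (ℕP.+-identityʳ a) refl (ℕP.+-identityʳ b) refl (pairs 0 _ refl)

pairs-inner : ∀ {f g a b j n M} → Pairs f g a b (suc j) n M → Pairs f g (suc a) (suc b) j n M
pairs-inner {f} {g} {a} {b} {j} {n} pairs i k refl =
  pair-reindex f g (ℕP.+-suc a i) (shift a) (ℕP.+-suc b i) (shift b) (pairs (suc i) k refl)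
  where
  shift : ∀ c → c ℕ.+ suc j ℕ.+ n ℕ.+ k ≡ suc c ℕ.+ j ℕ.+ n ℕ.+ k
  shift c = cong (λ d → d ℕ.+ n ℕ.+ k) (ℕP.+-suc c j)

shell-mod : ∀ f g a b j n M → Pairs f g a b j n M → shell f a j n ≡ shell g b j n [modℤ M ]
shell-mod f g a b zero    n M pairs = mod-refl (+ 1 · + 1)
shell-mod f g a b (suc j) n M pairs =
  subst₂ (λ x y → x ≡ y [modℤ M ]) (sym (shell-peel f a j n)) (sym (shell-peel g b j n))
    (mod-* (pairs-outer {f} {g} {a} {b} {j} {n} {M} pairs)
           (shell-mod f g (suc a) (suc b) j n M (pairs-inner {f} {g} {a} {b} {j} {n} {M} pairs)))

-- The factor 4k + r of 4ⁿ (r/4)ₙ.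
term : ℕ → ℕ → ℤ
term r k = + (r ℕ.+ k ℕ.* 4)

term-witness : ∀ r s t r' u v {n} q →
  (r ℕ.+ s ℕ.* 4) ℕ.* (r ℕ.+ t ℕ.* 4) ℕ.+ q ℕ.* n ≡ (r' ℕ.+ u ℕ.* 4) ℕ.* (r' ℕ.+ v ℕ.* 4) →
  term r s · term r t ≡ term r' u · term r' v [modℤ n ]
term-witness r s t r' u v q =
  mod-witness (r ℕ.+ s ℕ.* 4) (r ℕ.+ t ℕ.* 4) (r' ℕ.+ u ℕ.* 4) (r' ℕ.+ v ℕ.* 4) q

-- Let P = 4m + 1.  The pairs of the shell of 4k+3 over k ∈ [0, 2m) and of the
-- shell of 4k+1 over k ∈ [2m+1, 4m+1) are (P − 4t − 2)(P + 4t + 2) and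
-- (3P − 4t − 2)(3P + 4t + 2); they differ by 8P².
pairs-outer-halves : ∀ m → let P = 1 ℕ.+ m ℕ.* 4 in
  Pairs (term 3) (term 1) 0 (m ℕ.+ 1 ℕ.+ m) m 0 (P ℕ.* P)
pairs-outer-halves .(suc (i ℕ.+ k)) i k refl =
  term-witness 3 i (m ℕ.+ 0 ℕ.+ k) 1 (b ℕ.+ i) (b ℕ.+ m ℕ.+ 0 ℕ.+ k) 8 (identity i k)
  where
  m : ℕ
  m = suc (i ℕ.+ k)
  b : ℕ
  b = m ℕ.+ 1 ℕ.+ m
  identity : ∀ i k → let m = suc (i ℕ.+ k); P = 1 ℕ.+ m ℕ.* 4; b = m ℕ.+ 1 ℕ.+ m in
    (3 ℕ.+ i ℕ.* 4) ℕ.* (3 ℕ.+ (m ℕ.+ 0 ℕ.+ k) ℕ.* 4) ℕ.+ 8 ℕ.* (P ℕ.* P)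
      ≡ (1 ℕ.+ (b ℕ.+ i) ℕ.* 4) ℕ.* (1 ℕ.+ (b ℕ.+ m ℕ.+ 0 ℕ.+ k) ℕ.* 4)
  identity = ℕSolver.solve-∀

-- The pairs of the shell of 4k+1 over k ∈ [0, 2m+1) and of 4k+3 over
-- k ∈ [2m, 4m+1) (each omitting its centre) are (P − 4t − 4)(P + 4t + 4) and
-- (3P − 4t − 4)(3P + 4t + 4); again they differ by 8P².
pairs-centre-halves : ∀ m → let P = 1 ℕ.+ m ℕ.* 4 in
  Pairs (term 1) (term 3) 0 (m ℕ.+ 0 ℕ.+ m) m 1 (P ℕ.* P)
pairs-centre-halves .(suc (i ℕ.+ k)) i k refl =
  term-witness 1 i (m ℕ.+ 1 ℕ.+ k) 3 (b ℕ.+ i) (b ℕ.+ m ℕ.+ 1 ℕ.+ k) 8 (identity i k)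
  where
  m : ℕ
  m = suc (i ℕ.+ k)
  b : ℕ
  b = m ℕ.+ 0 ℕ.+ m
  identity : ∀ i k → let m = suc (i ℕ.+ k); P = 1 ℕ.+ m ℕ.* 4; b = m ℕ.+ 0 ℕ.+ m in
    (1 ℕ.+ i ℕ.* 4) ℕ.* (1 ℕ.+ (m ℕ.+ 1 ℕ.+ k) ℕ.* 4) ℕ.+ 8 ℕ.* (P ℕ.* P)
      ≡ (3 ℕ.+ (b ℕ.+ i) ℕ.* 4) ℕ.* (3 ℕ.+ (b ℕ.+ m ℕ.+ 1 ℕ.+ k) ℕ.* 4)
  identity = ℕSolver.solve-∀

∏-threes : ∀ m → let p = 1 ℕ.+ m ℕ.* 4 in
  ∏ (term 3) 0 p ≡ + p · (+ 3 · (shell (term 3) 0 m 0 · shell (term 3) (m ℕ.+ 0 ℕ.+ m) m 1))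
∏-threes m = begin
    ∏ (term 3) 0 p
  ≡⟨ cong (∏ (term 3) 0) (length-split m) ⟩
    ∏ (term 3) 0 ((m ℕ.+ 0 ℕ.+ m) ℕ.+ (m ℕ.+ 1 ℕ.+ m))
  ≡⟨ ∏-split (term 3) 0 (m ℕ.+ 0 ℕ.+ m) (m ℕ.+ 1 ℕ.+ m) ⟩
    ∏ (term 3) 0 (m ℕ.+ 0 ℕ.+ m) · ∏ (term 3) (m ℕ.+ 0 ℕ.+ m) (m ℕ.+ 1 ℕ.+ m)
  ≡⟨ cong₂ _·_ (∏-shell (term 3) 0 m 0) (∏-shell (term 3) (m ℕ.+ 0 ℕ.+ m) m 1) ⟩
    (+ 1 · A) · ((+ 1 · term 3 (m ℕ.+ 0 ℕ.+ m ℕ.+ m ℕ.+ 0)) · B)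
  ≡⟨ cong (λ c → (+ 1 · A) · ((+ 1 · c) · B)) centre ⟩
    (+ 1 · A) · ((+ 1 · (+ 3 · + p)) · B)
  ≡⟨ rearrange (+ 3) (+ p) A B ⟩
    + p · (+ 3 · (A · B))
  ∎
  where
  open ≡-Reasoning
  p : ℕ
  p = 1 ℕ.+ m ℕ.* 4
  A : ℤ
  A = shell (term 3) 0 m 0
  B : ℤ
  B = shell (term 3) (m ℕ.+ 0 ℕ.+ m) m 1
  length-split : ∀ m → 1 ℕ.+ m ℕ.* 4 ≡ (m ℕ.+ 0 ℕ.+ m) ℕ.+ (m ℕ.+ 1 ℕ.+ m)
  length-split = ℕSolver.solve-∀
  centre-identity : ∀ m → 3 ℕ.+ (m ℕ.+ 0 ℕ.+ m ℕ.+ m ℕ.+ 0) ℕ.* 4 ≡ 3 ℕ.* (1 ℕ.+ m ℕ.* 4)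
  centre-identity = ℕSolver.solve-∀
  centre : term 3 (m ℕ.+ 0 ℕ.+ m ℕ.+ m ℕ.+ 0) ≡ + 3 · + p
  centre = trans (cong +_ (centre-identity m)) (ℤP.pos-* 3 p)
  rearrange : ∀ (t p a b : ℤ) → (+ 1 · a) · ((+ 1 · (t · p)) · b) ≡ p · (t · (a · b))
  rearrange = solve-∀

∏-ones : ∀ m → let p = 1 ℕ.+ m ℕ.* 4 in
  + 3 · ∏ (term 1) 0 p ≡ + p · (+ 3 · (shell (term 1) (m ℕ.+ 1 ℕ.+ m) m 0 · shell (term 1) 0 m 1))
∏-ones m = begin
    + 3 · ∏ (term 1) 0 p
  ≡⟨ cong (λ n → + 3 · ∏ (term 1) 0 n) (length-split m) ⟩
    + 3 · ∏ (term 1) 0 ((m ℕ.+ 1 ℕ.+ m) ℕ.+ (m ℕ.+ 0 ℕ.+ m))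
  ≡⟨ cong (+ 3 ·_) (∏-split (term 1) 0 (m ℕ.+ 1 ℕ.+ m) (m ℕ.+ 0 ℕ.+ m)) ⟩
    + 3 · (∏ (term 1) 0 (m ℕ.+ 1 ℕ.+ m) · ∏ (term 1) (m ℕ.+ 1 ℕ.+ m) (m ℕ.+ 0 ℕ.+ m))
  ≡⟨ cong (+ 3 ·_) (cong₂ _·_ (∏-shell (term 1) 0 m 1) (∏-shell (term 1) (m ℕ.+ 1 ℕ.+ m) m 0)) ⟩
    + 3 · ((+ 1 · term 1 (m ℕ.+ 0)) · A · (+ 1 · B))
  ≡⟨ cong (λ c → + 3 · ((+ 1 · c) · A · (+ 1 · B))) centre ⟩
    + 3 · ((+ 1 · + p) · A · (+ 1 · B))
  ≡⟨ rearrange (+ p) A B ⟩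
    + p · (+ 3 · (B · A))
  ∎
  where
  open ≡-Reasoning
  p : ℕ
  p = 1 ℕ.+ m ℕ.* 4
  A : ℤ
  A = shell (term 1) 0 m 1
  B : ℤ
  B = shell (term 1) (m ℕ.+ 1 ℕ.+ m) m 0
  length-split : ∀ m → 1 ℕ.+ m ℕ.* 4 ≡ (m ℕ.+ 1 ℕ.+ m) ℕ.+ (m ℕ.+ 0 ℕ.+ m)
  length-split = ℕSolver.solve-∀
  centre : term 1 (m ℕ.+ 0) ≡ + p
  centre = cong (λ k → + (1 ℕ.+ k ℕ.* 4)) (ℕP.+-identityʳ m)
  rearrange : ∀ (p a b : ℤ) → + 3 · ((+ 1 · p) · a · (+ 1 · b)) ≡ p · (+ 3 · (b · a))
  rearrange = solve-∀

-- The integer form of the theorem: for p = 4m + 1,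
--   ∏_{k<p} (4k+3) ≡ 3 ∏_{k<p} (4k+1)  (mod p³).
-- Both sides are p times 3·(product of two shells), and the shells agree mod p².
integer-congruence : ∀ m → let p = 1 ℕ.+ m ℕ.* 4 in
  ∏ (term 3) 0 p ≡ + 3 · ∏ (term 1) 0 p [modℤ p ^ 3 ]
integer-congruence m =
  subst₂ (λ x y → x ≡ y [modℤ p ^ 3 ]) (sym (∏-threes m)) (sym (∏-ones m))
    (subst (λ M → + p · (+ 3 · (A₃ · B₃)) ≡ + p · (+ 3 · (A₁ · B₁)) [modℤ M ]) cube
      (mod-scale p (mod-* (mod-refl (+ 3)) (mod-* outer-shells centre-shells))))
  where
  p : ℕ
  p = 1 ℕ.+ m ℕ.* 4
  A₃ : ℤ
  A₃ = shell (term 3) 0 m 0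
  B₃ : ℤ
  B₃ = shell (term 3) (m ℕ.+ 0 ℕ.+ m) m 1
  A₁ : ℤ
  A₁ = shell (term 1) (m ℕ.+ 1 ℕ.+ m) m 0
  B₁ : ℤ
  B₁ = shell (term 1) 0 m 1
  outer-shells : A₃ ≡ A₁ [modℤ p ℕ.* p ]
  outer-shells = shell-mod (term 3) (term 1) 0 (m ℕ.+ 1 ℕ.+ m) m 0 (p ℕ.* p) (pairs-outer-halves m)
  centre-shells : B₃ ≡ B₁ [modℤ p ℕ.* p ]
  centre-shells =
    mod-sym (shell-mod (term 1) (term 3) 0 (m ℕ.+ 0 ℕ.+ m) m 1 (p ℕ.* p) (pairs-centre-halves m))
  cube : p ℕ.* (p ℕ.* p) ≡ p ^ 3
  cube = cong (λ c → p ℕ.* (p ℕ.* c)) (sym (ℕP.*-identityʳ p))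

4^n≢0 : ∀ n → ℕ.NonZero (4 ^ n)
4^n≢0 n = ℕP.m^n≢0 4 n

-- Arithmetic of unnormalised fractions i/d: these hold by computation once the
-- denominators are exposed as successors.
toℚᵘ-/ : ∀ i d .{{_ : ℕ.NonZero d}} → ℚ.toℚᵘ (i / d) ≃ i ℚᵘ./ d
toℚᵘ-/ i (suc d) = ℚP.toℚᵘ-fromℚᵘ (i ℚᵘ./ suc d)

fraction-* : ∀ a b c d .{{_ : ℕ.NonZero b}} .{{_ : ℕ.NonZero d}} →
  (a ℚᵘ./ b) ℚᵘ.* (c ℚᵘ./ d) ≡ ((a · c) ℚᵘ./ (b ℕ.* d)) {{ℕP.m*n≢0 b d}}
fraction-* a (suc b) c (suc d) = refl

poch-fraction : ∀ r n → ℚ.toℚᵘ (poch ((+ r) / 4) n) ≃ (∏ (term r) 0 n ℚᵘ./ 4 ^ n) {{4^n≢0 n}}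
poch-fraction r zero    = ℚᵘP.≃-refl
poch-fraction r (suc n) = begin
    ℚ.toℚᵘ (poch a n ℚ.* (a ℚ.+ (+ n) / 1))
  ≈⟨ ℚP.toℚᵘ-homo-* (poch a n) (a ℚ.+ (+ n) / 1) ⟩
    ℚ.toℚᵘ (poch a n) ℚᵘ.* ℚ.toℚᵘ (a ℚ.+ (+ n) / 1)
  ≈⟨ ℚᵘP.*-cong (poch-fraction r n)
       (ℚᵘP.≃-trans (ℚP.toℚᵘ-homo-+ a ((+ n) / 1)) (ℚᵘP.+-cong (toℚᵘ-/ (+ r) 4) (toℚᵘ-/ (+ n) 1))) ⟩
    (N ℚᵘ./ 4 ^ n) {{4^n≢0 n}} ℚᵘ.* ((+ r ℚᵘ./ 4) ℚᵘ.+ (+ n ℚᵘ./ 1))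
  ≡⟨ fraction-* N (4 ^ n) (+ r · + 1 + + n · + 4) 4 {{4^n≢0 n}} ⟩
    ((N · (+ r · + 1 + + n · + 4)) ℚᵘ./ (4 ^ n ℕ.* 4)) {{ℕP.m*n≢0 (4 ^ n) 4 {{4^n≢0 n}}}}
  ≡⟨ ℚᵘP./-cong {{ℕP.m*n≢0 (4 ^ n) 4 {{4^n≢0 n}}}} {{4^n≢0 (suc n)}}
                (cong (N ·_) numerator) (ℕP.*-comm (4 ^ n) 4) ⟩
    ((N · term r n) ℚᵘ./ 4 ^ suc n) {{4^n≢0 (suc n)}}
  ∎
  where
  open ℚᵘP.≃-Reasoning
  a : ℚ.ℚ
  a = (+ r) / 4
  N : ℤ
  N = ∏ (term r) 0 n
  numerator : + r · + 1 + + n · + 4 ≡ term r n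
  numerator = trans (cong₂ _+_ (ℤP.*-identityʳ (+ r)) (sym (ℤP.pos-* n 4)))
                    (sym (ℤP.pos-+ r (n ℕ.* 4)))

fraction-combination : ∀ x y k d .{{_ : ℕ.NonZero d}} →
  (x ℚᵘ./ d) ℚᵘ.+ ℚᵘ.- ((+ k ℚᵘ./ 1) ℚᵘ.* (y ℚᵘ./ d)) ≃ (x - + k · y) ℚᵘ./ d
fraction-combination x y k (suc d) rewrite ℕP.+-identityʳ d =
  *≡* (common-denominator x y (+ k) (+ suc d))
  where
  common-denominator : ∀ (x y k D : ℤ) → (x · D + - (k · y) · D) · D ≡ (x - k · y) · (D · D)
  common-denominator = solve-∀

difference-fraction : ∀ n →
  ℚ.toℚᵘ (poch ((+ 3) / 4) n ℚ.- ((+ 3) / 1) * poch ((+ 1) / 4) n)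
    ≃ ((∏ (term 3) 0 n - + 3 · ∏ (term 1) 0 n) ℚᵘ./ 4 ^ n) {{4^n≢0 n}}
difference-fraction n = begin
    ℚ.toℚᵘ (X ℚ.+ ℚ.- (three * Y))
  ≈⟨ ℚP.toℚᵘ-homo-+ X (ℚ.- (three * Y)) ⟩
    ℚ.toℚᵘ X ℚᵘ.+ ℚ.toℚᵘ (ℚ.- (three * Y))
  ≈⟨ ℚᵘP.+-congʳ (ℚ.toℚᵘ X)
       (ℚᵘP.≃-trans (ℚP.toℚᵘ-homo‿- (three * Y)) (ℚᵘP.-‿cong (ℚP.toℚᵘ-homo-* three Y))) ⟩
    ℚ.toℚᵘ X ℚᵘ.+ ℚᵘ.- (ℚ.toℚᵘ three ℚᵘ.* ℚ.toℚᵘ Y)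
  ≈⟨ ℚᵘP.+-cong (poch-fraction 3 n) (ℚᵘP.-‿cong (ℚᵘP.*-cong (toℚᵘ-/ (+ 3) 1) (poch-fraction 1 n))) ⟩
    (N₃ ℚᵘ./ 4 ^ n) {{4^n≢0 n}} ℚᵘ.+ ℚᵘ.- ((+ 3 ℚᵘ./ 1) ℚᵘ.* (N₁ ℚᵘ./ 4 ^ n) {{4^n≢0 n}})
  ≈⟨ fraction-combination N₃ N₁ 3 (4 ^ n) {{4^n≢0 n}} ⟩
    ((N₃ - + 3 · N₁) ℚᵘ./ 4 ^ n) {{4^n≢0 n}}
  ∎
  where
  open ℚᵘP.≃-Reasoning
  X : ℚ.ℚ
  X = poch ((+ 3) / 4) n
  Y : ℚ.ℚ
  Y = poch ((+ 1) / 4) n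
  three : ℚ.ℚ
  three = (+ 3) / 1
  N₃ : ℤ
  N₃ = ∏ (term 3) 0 n
  N₁ : ℤ
  N₁ = ∏ (term 1) 0 n

coprime-power-divisor : ∀ {m n o} → Coprime m n → ∀ k → m ∣ℕ n ^ k ℕ.* o → m ∣ℕ o
coprime-power-divisor {m} {n} {o} coprime zero    m∣o =
  subst (m ∣ℕ_) (ℕP.*-identityˡ o) m∣o
coprime-power-divisor {m} {n} {o} coprime (suc k) m∣nᵏ⁺¹o =
  coprime-power-divisor coprime k
    (coprime-divisor coprime (subst (m ∣ℕ_) (ℕP.*-assoc n (n ^ k) o) m∣nᵏ⁺¹o))

coprime-1+tn : ∀ t n → Coprime (1 ℕ.+ t ℕ.* n) n
coprime-1+tn zero    n = 1-coprimeTo n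
coprime-1+tn (suc t) n =
  subst (λ a → Coprime a n) (ℕP.+-suc n (t ℕ.* n)) (coprime-+ (coprime-1+tn t n))

-- If q = i / bᵏ, and M is coprime to b and divides i, then M divides the
-- (reduced) numerator of q:  from  ↥q · bᵏ = i · ↧q  cancel the bᵏ.
numerator-divisible : ∀ {M b} k (q : ℚ.ℚ) i .{{_ : ℕ.NonZero (b ^ k)}} → Coprime M b →
  ℚ.toℚᵘ q ≃ i ℚᵘ./ b ^ k → M ∣ℕ ∣ i ∣ → M ∣ℕ ∣ ℚ.↥ q ∣
numerator-divisible {M} {b} k q i coprime (*≡* cross) M∣i =
  coprime-power-divisor coprime k (subst (M ∣ℕ_) absolute-cross (ℕDiv.∣m⇒∣m*n _ M∣i))
  where
  absolute-cross : ∣ i ∣ ℕ.* ∣ ℚ.↧ q ∣ ≡ b ^ k ℕ.* ∣ ℚ.↥ q ∣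
  absolute-cross = begin
      ∣ i ∣ ℕ.* ∣ ℚ.↧ q ∣
    ≡⟨ ℤP.abs-* i (ℚ.↧ q) ⟨
      ∣ i · ℚ.↧ q ∣
    ≡⟨ cong ∣_∣ integer-cross ⟨
      ∣ ℚ.↥ q · + (b ^ k) ∣
    ≡⟨ ℤP.abs-* (ℚ.↥ q) (+ (b ^ k)) ⟩
      ∣ ℚ.↥ q ∣ ℕ.* b ^ k
    ≡⟨ ℕP.*-comm ∣ ℚ.↥ q ∣ (b ^ k) ⟩
      b ^ k ℕ.* ∣ ℚ.↥ q ∣
    ∎
    where
    open ≡-Reasoning
    integer-cross : ℚ.↥ q · + (b ^ k) ≡ i · ℚ.↧ q
    integer-cross = begin
        ℚ.↥ q · + (b ^ k)
      ≡⟨ cong₂ _·_ (ℚP.↥ᵘ-toℚᵘ q) (ℚᵘP.↧[n/d]≡d i (b ^ k)) ⟨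
        ℚᵘ.↥ (ℚ.toℚᵘ q) · ℚᵘ.↧ (i ℚᵘ./ b ^ k)
      ≡⟨ cross ⟩
        ℚᵘ.↥ (i ℚᵘ./ b ^ k) · ℚᵘ.↧ (ℚ.toℚᵘ q)
      ≡⟨ cong₂ _·_ (ℚᵘP.↥[n/d]≡n i (b ^ k)) (ℚP.↧ᵘ-toℚᵘ q) ⟩
        i · ℚ.↧ q
      ∎

-- p³ ≡ 1 (mod 4) for p ≡ 1 (mod 4), so p³ is coprime to the denominators 4ⁿ.
cube-coprime-to-4 : ∀ m → Coprime ((1 ℕ.+ m ℕ.* 4) ^ 3) 4
cube-coprime-to-4 m = subst (λ a → Coprime a 4) (sym (cube m)) (coprime-1+tn t 4)
  where
  t : ℕ
  t = 3 ℕ.* m ℕ.+ 12 ℕ.* m ℕ.* m ℕ.+ 16 ℕ.* m ℕ.* m ℕ.* m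
  cube : ∀ m → let p = 1 ℕ.+ m ℕ.* 4 in
    p ℕ.* (p ℕ.* (p ℕ.* 1)) ≡ 1 ℕ.+ (3 ℕ.* m ℕ.+ 12 ℕ.* m ℕ.* m ℕ.+ 16 ℕ.* m ℕ.* m ℕ.* m) ℕ.* 4
  cube = ℕSolver.solve-∀

-- The theorem for every p = 4m + 1: the numerator
-- of (3/4)ₚ − 3 (1/4)ₚ = (∏(4k+3) − 3 ∏(4k+1)) / 4ᵖ is divisible by p³.
quarter-pochhammer-congruence : ∀ m → let p = 1 ℕ.+ m ℕ.* 4 in
  poch ((+ 3) / 4) p ≡ℚ ((+ 3) / 1) * poch ((+ 1) / 4) p [mod p ^ 3 ]
quarter-pochhammer-congruence m =
  numerator-divisible p _ _ {{4^n≢0 p}} (cube-coprime-to-4 m) (difference-fraction p)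
    (∣⇒∣ᵤ (divides-difference (integer-congruence m)))
  where
  p : ℕ
  p = 1 ℕ.+ m ℕ.* 4

lemma2p1 : (p : ℕ) → Prime p → p % 4 ≡ 1 →
    poch ((+ 3) / 4) p ≡ℚ ((+ 3) / 1) * poch ((+ 1) / 4) p [mod p ^ 3 ]
lemma2p1 p _ p%4≡1 =
  subst (λ n → poch ((+ 3) / 4) n ≡ℚ ((+ 3) / 1) * poch ((+ 1) / 4) n [mod n ^ 3 ])
    (sym p≡1+4m) (quarter-pochhammer-congruence (p ℕ./ 4))
  where
  p≡1+4m : p ≡ 1 ℕ.+ (p ℕ./ 4) ℕ.* 4
  p≡1+4m = trans (m≡m%n+[m/n]*n p 4) (cong (ℕ._+ (p ℕ./ 4) ℕ.* 4) p%4≡1)
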